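{- Let $A$ be a $\{ -,\triangleright\}$-algebra and $\theta$ a representation of $A$ by partial functions. Then $\theta$ is atomic if and only if it is complete.
   Context: On partial functions, $f-g=\{(x,y)\in f\mid (x,y)\notin g\}$ and $f\triangleright g=\{(x,y)\in g\mid x\in\mathrm{dom}(f)\}$. A representation of $A$ by partial functions is an isomorphism $\theta$ from $A$ onto a set of partial functions on a base set $X$ closed under these operations, viewed as a map into the poset of all partial functions on $X$ ordered by inclusion. In $A$ write $a\cdot b:=a-(a-b)$, $a\le b\iff a\cdot b=a$ (represented by inclusion), with least element $0=a-a$; atoms are minimal nonzero elements. $\theta$ is atomic if whenever $(x,y)\in\theta(a)$ for some $a\in A$, then $(x,y)\in\theta(b)$ for some atom $b$ of $A$. $\theta$ is complete if for every nonempty $S\subseteq A$ whose meet $\bigwedge S$ exists in $A$, $\theta(\bigwedge S)=\bigcap\theta[S]$, and for every $S\subseteq A$ whose join $\bigvee S$ exists, $\bigcup\theta[S]$ is a partial function equal to $\theta(\bigvee S)$ (these two conditions being equivalent). -}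

module Defs where

open import Level using (0ℓ)
open import Data.Product using (Σ; ∃; _×_; _,_)
open import Relation.Nullary using (¬_)
open import Relation.Binary.PropositionalEquality using (_≡_; _≢_)

record DAlg : Set₁ where
  infixl 6 _⊖_
  infixl 5 _▷_
  field
    Carrier : Set
    _⊖_     : Carrier → Carrier → Carrier
    _▷_     : Carrier → Carrier → Carrier

Rel₂ : Set → Set₁
Rel₂ X = X → X → Set

IsPartialFunction : {X : Set} → Rel₂ X → Set
IsPartialFunction {X} f = ∀ {x y z : X} → f x y → f x z → y ≡ z

_⊆ᵣ_ : {X : Set} → Rel₂ X → Rel₂ X → Set
f ⊆ᵣ g = ∀ {x y} → f x y → g x y

_≐_ : {X : Set} → Rel₂ X → Rel₂ X → Set
f ≐ g = (f ⊆ᵣ g) × (g ⊆ᵣ f)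

_−ᵣ_ : {X : Set} → Rel₂ X → Rel₂ X → Rel₂ X
(f −ᵣ g) x y = f x y × ¬ g x y

_▷ᵣ_ : {X : Set} → Rel₂ X → Rel₂ X → Rel₂ X
(f ▷ᵣ g) x y = g x y × ∃ (λ z → f x z)

-- A representation of A by partial functions on X: an isomorphism onto a
-- set of partial functions closed under the operations, i.e. an injective
-- map into partial functions on X preserving - and ▷.
record Representation (A : DAlg) (X : Set) : Set₁ where
  open DAlg A
  field
    θ          : Carrier → Rel₂ X
    partial    : ∀ a → IsPartialFunction (θ a)
    injective  : ∀ a b → θ a ≐ θ b → a ≡ b
    pres-⊖     : ∀ a b → θ (a ⊖ b) ≐ (θ a −ᵣ θ b)
    pres-▷     : ∀ a b → θ (a ▷ b) ≐ (θ a ▷ᵣ θ b)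

module Order (A : DAlg) where
  open DAlg A

  _·_ : Carrier → Carrier → Carrier
  a · b = a ⊖ (a ⊖ b)

  _≤_ : Carrier → Carrier → Set
  a ≤ b = a · b ≡ a

  -- 0 = a - a ; c is nonzero iff c ≠ c - c (= 0)
  NonZero : Carrier → Set
  NonZero c = c ≢ (c ⊖ c)

  IsAtom : Carrier → Set
  IsAtom b = NonZero b × (∀ c → NonZero c → c ≤ b → c ≡ b)

  Subset : Set₁
  Subset = Carrier → Set

  IsMeet : Subset → Carrier → Set
  IsMeet S m = (∀ s → S s → m ≤ s) × (∀ l → (∀ s → S s → l ≤ s) → l ≤ m)

  IsJoin : Subset → Carrier → Set
  IsJoin S j = (∀ s → S s → s ≤ j) × (∀ u → (∀ s → S s → s ≤ u) → j ≤ u)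

module _ {A : DAlg} {X : Set} (ρ : Representation A X) where
  open DAlg A
  open Order A
  open Representation ρ

  Atomic : Set
  Atomic = ∀ a {x y} → θ a x y → Σ Carrier (λ b → IsAtom b × θ b x y)

  Complete : Set₁
  Complete =
    (∀ (S : Subset) → Σ Carrier S → ∀ m → IsMeet S m →
       ∀ x y → (θ m x y → ∀ s → S s → θ s x y) × ((∀ s → S s → θ s x y) → θ m x y))
    × (∀ (S : Subset) → ∀ j → IsJoin S j →
       ∀ x y → (θ j x y → Σ Carrier (λ s → S s × θ s x y)) × (Σ Carrier (λ s → S s × θ s x y) → θ j x y))

-- A representation turns ≤ into inclusion, so an atom containing a point
-- (x,y) lies below every element containing (x,y).  Given atomicity, a point
-- of every θ s lies in an atom below all s, hence below the meet; and a
-- point of θ(⋁S) lying in no θ s gives an atom b with ⋁S ≤ ⋁S - b, which is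
-- absurd.  Conversely, the elements containing (x,y) always have a meet if
-- (x,y) lies in no atom: every lower bound l is empty, since l ∌ (x,y) makes
-- l ≤ a - l, while l ∋ (x,y) makes l itself an atom.  That meet is 0, so
-- completeness would put (x,y) into θ 0 = ∅.
module Submission where

open import Defs
open import Level using (0ℓ)
open import Axiom.ExcludedMiddle using (ExcludedMiddle)
open import Function.Bundles using (_⇔_; mk⇔)
open import Data.Product using (Σ; _×_; _,_; proj₁; proj₂)
open import Data.Empty using (⊥-elim)
open import Relation.Nullary using (¬_; yes; no; contradiction)
open import Relation.Binary.PropositionalEquality using (_≡_; sym; subst)

module _ {A : DAlg} {X : Set} (ρ : Representation A X) where
  open DAlg A
  open Order A
  open Representation ρ

  MeetComplete : Set₁
  MeetComplete = ∀ (S : Subset) → Σ Carrier S → ∀ m → IsMeet S m →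
    ∀ x y → (θ m x y → ∀ s → S s → θ s x y) × ((∀ s → S s → θ s x y) → θ m x y)

  JoinComplete : Set₁
  JoinComplete = ∀ (S : Subset) → ∀ j → IsJoin S j →
    ∀ x y → (θ j x y → Σ Carrier (λ s → S s × θ s x y)) × (Σ Carrier (λ s → S s × θ s x y) → θ j x y)

module RepresentationProperties (em : ExcludedMiddle 0ℓ) {A : DAlg} {X : Set} (ρ : Representation A X) where
  open DAlg A
  open Order A
  open Representation ρ

  θ-⊖⁺ : ∀ {a b x y} → θ a x y → ¬ θ b x y → θ (a ⊖ b) x y
  θ-⊖⁺ {a} {b} ta ¬tb = proj₂ (pres-⊖ a b) (ta , ¬tb)

  θ-⊖⁻ : ∀ {a b x y} → θ (a ⊖ b) x y → θ a x y × ¬ θ b x y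
  θ-⊖⁻ {a} {b} = proj₁ (pres-⊖ a b)

  θ-zero : ∀ a {x y} → ¬ θ (a ⊖ a) x y
  θ-zero a t = let ta , ¬ta = θ-⊖⁻ t in ¬ta ta

  θ-·⁺ : ∀ {a b x y} → θ a x y → θ b x y → θ (a · b) x y
  θ-·⁺ ta tb = θ-⊖⁺ ta (λ t → proj₂ (θ-⊖⁻ t) tb)

  θ-·⁻ : ∀ {a b x y} → θ (a · b) x y → θ a x y × θ b x y
  θ-·⁻ {a} {b} {x} {y} t with θ-⊖⁻ t | em {θ b x y}
  ... | ta , _  | yes tb = ta , tb
  ... | ta , ¬t | no ¬tb = contradiction (θ-⊖⁺ ta ¬tb) ¬t

  ⊆⇒≤ : ∀ {a b} → θ a ⊆ᵣ θ b → a ≤ b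
  ⊆⇒≤ {a} {b} a⊆b = injective (a · b) a ((λ t → proj₁ (θ-·⁻ t)) , λ t → θ-·⁺ t (a⊆b t))

  ≤⇒⊆ : ∀ {a b} → a ≤ b → θ a ⊆ᵣ θ b
  ≤⇒⊆ {a} {b} a≤b {x} {y} t = proj₂ (θ-·⁻ (subst (λ c → θ c x y) (sym a≤b) t))

  inhabited⇒NonZero : ∀ {c x y} → θ c x y → NonZero c
  inhabited⇒NonZero {c} {x} {y} t c≡0 = θ-zero c (subst (λ d → θ d x y) c≡0 t)

  empty⇒¬NonZero : ∀ {c} → (∀ {x y} → ¬ θ c x y) → ¬ NonZero c
  empty⇒¬NonZero {c} empty nz = nz (injective c (c ⊖ c) ((λ t → ⊥-elim (empty t)) , λ t → ⊥-elim (θ-zero c t)))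

  atom≤ : ∀ {b s x y} → IsAtom b → θ b x y → θ s x y → b ≤ s
  atom≤ {b} {s} (_ , minimal) tb ts =
    minimal (b · s) (inhabited⇒NonZero (θ-·⁺ tb ts)) (⊆⇒≤ (λ t → proj₁ (θ-·⁻ t)))

  Atomic⇒MeetComplete : Atomic ρ → MeetComplete ρ
  Atomic⇒MeetComplete atomic S (s₀ , s₀∈S) m (m≤S , glb) x y =
    (λ tm s s∈S → ≤⇒⊆ (m≤S s s∈S) tm) ,
    λ t∈S → let b , b-atom , tb = atomic s₀ (t∈S s₀ s₀∈S) in
            ≤⇒⊆ (glb b (λ s s∈S → atom≤ b-atom tb (t∈S s s∈S))) tb

  Atomic⇒JoinComplete : Atomic ρ → JoinComplete ρ
  Atomic⇒JoinComplete atomic S j (S≤j , lub) x y =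
    covered , λ (s , s∈S , ts) → ≤⇒⊆ (S≤j s s∈S) ts
    where
    covered : θ j x y → Σ Carrier (λ s → S s × θ s x y)
    covered tj with em {Σ Carrier (λ s → S s × θ s x y)} | atomic j tj
    ... | yes found    | _ = found
    ... | no uncovered | b , b-atom , tb =
      contradiction tb (proj₂ (θ-⊖⁻ (≤⇒⊆ (lub (j ⊖ b) S≤j⊖b) tj)))
      where
      S≤j⊖b : ∀ s → S s → s ≤ (j ⊖ b)
      S≤j⊖b s s∈S = ⊆⇒≤ λ ts → θ-⊖⁺ (≤⇒⊆ (S≤j s s∈S) ts)
        λ tb′ → uncovered (s , s∈S , ≤⇒⊆ (atom≤ b-atom tb′ ts) tb)

  module _ {x y : X} {l : Carrier} (l≤S : ∀ c → θ c x y → l ≤ c) where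

    lowerBound-disjoint : ∀ {c d x′ y′} → θ c x y → ¬ θ d x y → θ l x′ y′ → ¬ θ d x′ y′
    lowerBound-disjoint tc ¬td tl = proj₂ (θ-⊖⁻ (≤⇒⊆ (l≤S _ (θ-⊖⁺ tc ¬td)) tl))

    lowerBound-empty : ∀ {c} → θ c x y → ¬ θ l x y → ∀ {x′ y′} → ¬ θ l x′ y′
    lowerBound-empty tc ¬tl tl = lowerBound-disjoint tc ¬tl tl tl

    lowerBound-atom : θ l x y → IsAtom l
    lowerBound-atom tl = inhabited⇒NonZero tl , minimal
      where
      minimal : ∀ d → NonZero d → d ≤ l → d ≡ l
      minimal d nz d≤l with em {θ d x y}
      ... | yes td = injective d l (≤⇒⊆ d≤l , ≤⇒⊆ (l≤S d td))
      ... | no ¬td = ⊥-elim (empty⇒¬NonZero (λ t → lowerBound-disjoint tl ¬td (≤⇒⊆ d≤l t) t) nz)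

  MeetComplete⇒Atomic : MeetComplete ρ → Atomic ρ
  MeetComplete⇒Atomic complete a {x} {y} ta with em {Σ Carrier (λ b → IsAtom b × θ b x y)}
  ... | yes atom = atom
  ... | no noAtom =
    ⊥-elim (θ-zero a (proj₂ (complete (λ c → θ c x y) (a , ta) (a ⊖ a) zero-isMeet x y) (λ _ tc → tc)))
    where
    lowerBound-≤zero : ∀ l → (∀ c → θ c x y → l ≤ c) → l ≤ (a ⊖ a)
    lowerBound-≤zero l l≤S with em {θ l x y}
    ... | yes tl = ⊥-elim (noAtom (l , lowerBound-atom l≤S tl , tl))
    ... | no ¬tl = ⊆⇒≤ λ t → ⊥-elim (lowerBound-empty l≤S ta ¬tl t)

    zero-isMeet : IsMeet (λ c → θ c x y) (a ⊖ a)
    zero-isMeet = (λ _ _ → ⊆⇒≤ λ t → ⊥-elim (θ-zero a t)) , lowerBound-≤zero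

proposition6p10 : ExcludedMiddle 0ℓ → (A : DAlg) → (X : Set) → (ρ : Representation A X) →
    Atomic ρ ⇔ Complete ρ
proposition6p10 em A X ρ = mk⇔
  (λ atomic → Atomic⇒MeetComplete atomic , Atomic⇒JoinComplete atomic)
  (λ complete → MeetComplete⇒Atomic (proj₁ complete))
  where open RepresentationProperties em ρ
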